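{- A bipartite graph $B=(X,Y,E)$ is an ACB graph if and only if $B$ contains no induced subgraph isomorphic to $3K_2$, to $C_6$, or to $C_8$.
   Context: A bipartite graph $B=(X,Y,E)$ has color classes (stable sets) $X$ and $Y$ and all edges between $X$ and $Y$. A bipartite graph is chordal bipartite if it has no induced chordless cycle $C_{2k}$ with $k\ge 3$. The mirror (bipartite complement) $mir(B)=(X,Y,E')$ has the same color classes, and for $x\in X$, $y\in Y$, $xy\in E'$ iff $xy\notin E$. $B$ is auto-chordal-bipartite (ACB) if both $B$ and $mir(B)$ are chordal bipartite. $C_k$ is the chordless cycle on $k$ vertices; $3K_2$ is the disjoint union of three edges. -}

module Defs where

open import Data.Nat using (ℕ; zero; suc; _≤_; _*_; _≡ᵇ_)
open import Data.Fin using (Fin; toℕ)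
open import Data.Bool using (Bool; true; false; not; _∨_; _∧_)
open import Data.Sum using (_⊎_; inj₁; inj₂)
open import Data.Product using (Σ; _×_)
open import Function.Definitions using (Injective)
open import Relation.Binary.PropositionalEquality using (_≡_)
open import Relation.Nullary using (¬_)

-- A finite bipartite graph B = (X, Y, E) with X = Fin m, Y = Fin n,
-- edges given by a Boolean adjacency between X and Y.
record BipGraph : Set where
  constructor bip
  field
    m : ℕ
    n : ℕ
    E : Fin m → Fin n → Bool
open BipGraph public

V : BipGraph → Set
V B = Fin (m B) ⊎ Fin (n B)

adj : (B : BipGraph) → V B → V B → Bool
adj B (inj₁ x) (inj₂ y) = E B x y
adj B (inj₂ y) (inj₁ x) = E B x y
adj B (inj₁ _) (inj₁ _) = false
adj B (inj₂ _) (inj₂ _) = false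

mir : BipGraph → BipGraph
mir (bip m n E) = bip m n (λ x y → not (E x y))

HasInduced : (k : ℕ) → (Fin k → Fin k → Bool) → BipGraph → Set
HasInduced k H B =
  Σ (Fin k → V B) λ f → Injective _≡_ _≡_ f × (∀ i j → adj B (f i) (f j) ≡ H i j)

cycAdj : (k : ℕ) → Fin k → Fin k → Bool
cycAdj k i j =
  (suc (toℕ i) ≡ᵇ toℕ j) ∨ (suc (toℕ j) ≡ᵇ toℕ i)
  ∨ ((toℕ i ≡ᵇ 0) ∧ (suc (toℕ j) ≡ᵇ k))
  ∨ ((toℕ j ≡ᵇ 0) ∧ (suc (toℕ i) ≡ᵇ k))

threeK2Adj : Fin 6 → Fin 6 → Bool
threeK2Adj i j = pairOf (toℕ i) (toℕ j)
  where
  pairOf : ℕ → ℕ → Bool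
  pairOf 0 1 = true
  pairOf 1 0 = true
  pairOf 2 3 = true
  pairOf 3 2 = true
  pairOf 4 5 = true
  pairOf 5 4 = true
  pairOf _ _ = false

ChordalBipartite : BipGraph → Set
ChordalBipartite B = ∀ k → 3 ≤ k → ¬ HasInduced (2 * k) (cycAdj (2 * k)) B

ACB : BipGraph → Set
ACB B = ChordalBipartite B × ChordalBipartite (mir B)

-- Inside the vertex set of an induced copy of a graph H, the edges of mir B are exactly
-- the X–Y pairs that are not edges of H; along a path or cycle the sides alternate, so the
-- mirror of an induced C_{2k} is determined by the parity of positions, and the mirror of an
-- induced 3K₂ is a C₆ once each of its edges is oriented from X to Y. Hence a 3K₂ in B is a C₆
-- in mir B, while a C₆ (resp. C₈, C_{2k} with k ≥ 5) in mir B contains a 3K₂ (resp. C₈, C₆)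
-- in B; finally a C_{2k} with k ≥ 5 in B contains the 3K₂ formed by three of its edges that
-- are pairwise at distance ≥ 2.
module Submission where

open import Defs
open import Data.Bool using (Bool; true; false; not; _∧_; _xor_; if_then_else_)
open import Data.Bool.Properties as Bool using (not-involutive; not-distribˡ-xor; not-distribʳ-xor)
open import Data.Fin using (Fin; zero; suc; toℕ; inject₁; #_; _≟_)
open import Data.Fin.Properties using (all?; toℕ-inject₁)
open import Data.Nat using (ℕ; zero; suc; _+_; _*_; _≡ᵇ_; s≤s)
open import Data.Nat.Properties using (*-distribˡ-+; ≤-refl; n≤1+n)
open import Data.Product using (_×_; _,_; proj₁; proj₂)
open import Data.Sum using (_⊎_; inj₁; inj₂)
open import Data.Vec using ([]; _∷_; lookup)
open import Function using (_∘_; id)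
open import Function.Bundles using (_⇔_; mk⇔)
open import Function.Definitions using (Injective)
open import Relation.Binary.PropositionalEquality using (_≡_; refl; sym; trans; cong; cong₂; subst; module ≡-Reasoning)
open import Relation.Nullary using (¬_)
open import Relation.Nullary.Decidable using (True; toWitness; _×-dec_; _→-dec_)

inX : {X Y : Set} → X ⊎ Y → Bool
inX (inj₁ _) = true
inX (inj₂ _) = false

module _ (B : BipGraph) where

  adj-crosses : (a b : V B) → adj B a b ≡ true → inX b ≡ not (inX a)
  adj-crosses (inj₁ _) (inj₂ _) _ = refl
  adj-crosses (inj₂ _) (inj₁ _) _ = refl

  adj-mir : (a b : V B) → adj (mir B) a b ≡ (inX a xor inX b) ∧ not (adj B a b)
  adj-mir (inj₁ _) (inj₁ _) = refl
  adj-mir (inj₁ _) (inj₂ _) = refl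
  adj-mir (inj₂ _) (inj₁ _) = refl
  adj-mir (inj₂ _) (inj₂ _) = refl

  adj-mir-mir : (a b : V B) → adj (mir (mir B)) a b ≡ adj B a b
  adj-mir-mir (inj₁ _) (inj₁ _) = refl
  adj-mir-mir (inj₁ x) (inj₂ y) = not-involutive (E B x y)
  adj-mir-mir (inj₂ y) (inj₁ x) = not-involutive (E B x y)
  adj-mir-mir (inj₂ _) (inj₂ _) = refl

Adjacency : ℕ → Set
Adjacency k = Fin k → Fin k → Bool

record _⊑_ {l k} (H′ : Adjacency l) (H : Adjacency k) : Set where
  constructor embedding
  field
    embed           : Fin l → Fin k
    embed-injective : Injective _≡_ _≡_ embed
    embed-adj       : ∀ i j → H (embed i) (embed j) ≡ H′ i j

≗⇒⊑ : ∀ {k} {H H′ : Adjacency k} → (∀ i j → H i j ≡ H′ i j) → H′ ⊑ H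
≗⇒⊑ H≗H′ = embedding id id H≗H′

⊑-by-computation : ∀ {l k} {H′ : Adjacency l} {H : Adjacency k} (g : Fin l → Fin k) →
  {True (all? λ i → all? λ j → ((g i ≟ g j) →-dec (i ≟ j)) ×-dec (H (g i) (g j) Bool.≟ H′ i j))} →
  H′ ⊑ H
⊑-by-computation g {checked} = embedding g (proj₁ (pairwise _ _)) (λ i j → proj₂ (pairwise i j))
  where pairwise = toWitness checked

HasInduced-⊑ : ∀ {l k} {H′ : Adjacency l} {H : Adjacency k} {B} → H′ ⊑ H → HasInduced k H B → HasInduced l H′ B
HasInduced-⊑ (embedding g g-inj g-adj) (f , f-inj , f-adj) =
  f ∘ g , g-inj ∘ f-inj , λ i j → trans (f-adj (g i) (g j)) (g-adj i j)

HasInduced-mir-mir : ∀ {k} {H : Adjacency k} {B} → HasInduced k H (mir (mir B)) → HasInduced k H B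
HasInduced-mir-mir {B = B} (f , f-inj , f-adj) =
  f , f-inj , λ i j → trans (sym (adj-mir-mir B (f i) (f j))) (f-adj i j)

bipComplement : ∀ {k} → (Fin k → Bool) → Adjacency k → Adjacency k
bipComplement c H i j = (c i xor c j) ∧ not (H i j)

bipComplement-shift : ∀ {k} {c c′ : Fin k → Bool} {H : Adjacency k} (s : Bool) →
  (∀ i → c i ≡ s xor c′ i) → ∀ i j → bipComplement c H i j ≡ bipComplement c′ H i j
bipComplement-shift {c′ = c′} {H} s c≡s⊕c′ i j =
  cong (λ x → x ∧ not (H i j)) (trans (cong₂ _xor_ (c≡s⊕c′ i) (c≡s⊕c′ j)) (xor-cancel s (c′ i) (c′ j)))
  where
  xor-cancel : ∀ s a b → (s xor a) xor (s xor b) ≡ a xor b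
  xor-cancel false a b = refl
  xor-cancel true a b = begin
    not a xor not b      ≡⟨ not-distribˡ-xor a (not b) ⟨
    not (a xor not b)    ≡⟨ cong not (not-distribʳ-xor a b) ⟨
    not (not (a xor b))  ≡⟨ not-involutive (a xor b) ⟩
    a xor b              ∎
    where open ≡-Reasoning

mir-bipComplement : ∀ {k} {H : Adjacency k} B (h : HasInduced k H B) →
  HasInduced k (bipComplement (inX ∘ proj₁ h) H) (mir B)
mir-bipComplement B (f , f-inj , f-adj) =
  f , f-inj , λ i j → trans (adj-mir B (f i) (f j)) (cong (λ x → (inX (f i) xor inX (f j)) ∧ not x) (f-adj i j))

odd : ℕ → Bool
odd zero    = false
odd (suc n) = not (odd n)

alternating : ∀ {L} (a : Fin (suc L) → Bool) → (∀ i → a (suc i) ≡ not (a (inject₁ i))) →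
  ∀ i → a i ≡ a zero xor odd (toℕ i)
alternating a step zero = sym (Bool.xor-identityʳ (a zero))
alternating {suc L} a step (suc i) = begin
  a (suc i)                             ≡⟨ alternating (a ∘ suc) (step ∘ suc) i ⟩
  a (suc zero) xor odd (toℕ i)          ≡⟨ cong (_xor odd (toℕ i)) (step zero) ⟩
  not (a zero) xor odd (toℕ i)          ≡⟨ not-distribˡ-xor (a zero) (odd (toℕ i)) ⟨
  not (a zero xor odd (toℕ i))          ≡⟨ not-distribʳ-xor (a zero) (odd (toℕ i)) ⟩
  a zero xor odd (suc (toℕ i))          ∎
  where open ≡-Reasoning

≡ᵇ-refl : ∀ n → (n ≡ᵇ n) ≡ true
≡ᵇ-refl zero    = refl
≡ᵇ-refl (suc n) = ≡ᵇ-refl n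

cycAdj-consecutive : ∀ {L} (i : Fin L) → cycAdj (suc L) (inject₁ i) (suc i) ≡ true
cycAdj-consecutive i rewrite toℕ-inject₁ i | ≡ᵇ-refl (toℕ i) = refl

cycle-sides : ∀ {L B} (h : HasInduced (suc L) (cycAdj (suc L)) B) →
  ∀ i → inX (proj₁ h i) ≡ inX (proj₁ h zero) xor odd (toℕ i)
cycle-sides {B = B} (f , _ , f-adj) =
  alternating (inX ∘ f) λ i → adj-crosses B _ _ (trans (f-adj (inject₁ i) (suc i)) (cycAdj-consecutive i))

mir-cycle⇒bipComplement : ∀ {L B} → HasInduced (suc L) (cycAdj (suc L)) (mir B) →
  HasInduced (suc L) (bipComplement (odd ∘ toℕ) (cycAdj (suc L))) B
mir-cycle⇒bipComplement {B = B} h@(f , _ , _) =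
  HasInduced-mir-mir (HasInduced-⊑ (≗⇒⊑ (bipComplement-shift (inX (f zero)) (cycle-sides h)))
                                   (mir-bipComplement (mir B) h))

threeK2⊑long-cycle : ∀ p → threeK2Adj ⊑ cycAdj (10 + p)
threeK2⊑long-cycle p = ⊑-by-computation (lookup (# 0 ∷ # 1 ∷ # 3 ∷ # 4 ∷ # 6 ∷ # 7 ∷ []))

C6⊑bipComplement-long-cycle : ∀ p → cycAdj 6 ⊑ bipComplement (odd ∘ toℕ) (cycAdj (10 + p))
C6⊑bipComplement-long-cycle p = ⊑-by-computation (lookup (# 0 ∷ # 3 ∷ # 6 ∷ # 1 ∷ # 4 ∷ # 7 ∷ []))

threeK2⊑bipComplement-C6 : threeK2Adj ⊑ bipComplement (odd ∘ toℕ) (cycAdj 6)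
threeK2⊑bipComplement-C6 = ⊑-by-computation (lookup (# 0 ∷ # 3 ∷ # 1 ∷ # 4 ∷ # 2 ∷ # 5 ∷ []))

C8⊑bipComplement-C8 : cycAdj 8 ⊑ bipComplement (odd ∘ toℕ) (cycAdj 8)
C8⊑bipComplement-C8 = ⊑-by-computation (lookup (# 0 ∷ # 3 ∷ # 6 ∷ # 1 ∷ # 4 ∷ # 7 ∷ # 2 ∷ # 5 ∷ []))

matchingSides : Bool → Bool → Bool → Fin 6 → Bool
matchingSides t₀ t₁ t₂ = lookup (t₀ ∷ not t₀ ∷ t₁ ∷ not t₁ ∷ t₂ ∷ not t₂ ∷ [])

threeK2-sides : ∀ {B} (h : HasInduced 6 threeK2Adj B) → let f = proj₁ h in
  ∀ i → inX (f i) ≡ false xor matchingSides (inX (f (# 0))) (inX (f (# 2))) (inX (f (# 4))) i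
threeK2-sides {B} (f , _ , f-adj) = λ
  { zero                                → refl
  ; (suc zero)                          → crosses (# 0) (# 1) refl
  ; (suc (suc zero))                    → refl
  ; (suc (suc (suc zero)))              → crosses (# 2) (# 3) refl
  ; (suc (suc (suc (suc zero))))        → refl
  ; (suc (suc (suc (suc (suc zero)))))  → crosses (# 4) (# 5) refl }
  where
  crosses : ∀ i j → threeK2Adj i j ≡ true → inX (f j) ≡ not (inX (f i))
  crosses i j edge = adj-crosses B (f i) (f j) (trans (f-adj i j) edge)

-- The C₆ x₀ y₁ x₂ y₀ x₁ y₂, where xₑ and yₑ are the ends of the e-th edge lying in X and in Y.
hexagon : Bool → Bool → Bool → Fin 6 → Fin 6
hexagon t₀ t₁ t₂ = lookup (x t₀ (# 0) (# 1) ∷ y t₁ (# 2) (# 3) ∷ x t₂ (# 4) (# 5) ∷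
                           y t₀ (# 0) (# 1) ∷ x t₁ (# 2) (# 3) ∷ y t₂ (# 4) (# 5) ∷ [])
  where
  x y : Bool → Fin 6 → Fin 6 → Fin 6
  x t u v = if t then u else v
  y t u v = if t then v else u

C6⊑bipComplement-threeK2 : ∀ t₀ t₁ t₂ → cycAdj 6 ⊑ bipComplement (matchingSides t₀ t₁ t₂) threeK2Adj
C6⊑bipComplement-threeK2 false false false = ⊑-by-computation (hexagon false false false)
C6⊑bipComplement-threeK2 false false true  = ⊑-by-computation (hexagon false false true)
C6⊑bipComplement-threeK2 false true  false = ⊑-by-computation (hexagon false true  false)
C6⊑bipComplement-threeK2 false true  true  = ⊑-by-computation (hexagon false true  true)
C6⊑bipComplement-threeK2 true  false false = ⊑-by-computation (hexagon true  false false)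
C6⊑bipComplement-threeK2 true  false true  = ⊑-by-computation (hexagon true  false true)
C6⊑bipComplement-threeK2 true  true  false = ⊑-by-computation (hexagon true  true  false)
C6⊑bipComplement-threeK2 true  true  true  = ⊑-by-computation (hexagon true  true  true)

threeK2⇒mir-C6 : ∀ {B} → HasInduced 6 threeK2Adj B → HasInduced 6 (cycAdj 6) (mir B)
threeK2⇒mir-C6 {B} h@(f , _ , _) =
  HasInduced-⊑ (C6⊑bipComplement-threeK2 (inX (f (# 0))) (inX (f (# 2))) (inX (f (# 4))))
    (HasInduced-⊑ (≗⇒⊑ (bipComplement-shift false (threeK2-sides h))) (mir-bipComplement B h))

chordalBipartite-by-length : ∀ {B} →
  ¬ HasInduced 6 (cycAdj 6) B → ¬ HasInduced 8 (cycAdj 8) B →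
  (∀ p → ¬ HasInduced (10 + p) (cycAdj (10 + p)) B) → ChordalBipartite B
chordalBipartite-by-length no-C6 no-C8 no-long 3 _ = no-C6
chordalBipartite-by-length no-C6 no-C8 no-long 4 _ = no-C8
chordalBipartite-by-length {B} no-C6 no-C8 no-long (suc (suc (suc (suc (suc l))))) _ =
  subst (λ N → ¬ HasInduced N (cycAdj N) B) (sym (*-distribˡ-+ 2 5 l)) (no-long (2 * l))
chordalBipartite-by-length no-C6 no-C8 no-long 0 ()
chordalBipartite-by-length no-C6 no-C8 no-long 1 (s≤s ())
chordalBipartite-by-length no-C6 no-C8 no-long 2 (s≤s (s≤s ()))

proposition2 : (B : BipGraph) →
    ACB B ⇔ (¬ HasInduced 6 threeK2Adj B × ¬ HasInduced 6 (cycAdj 6) B × ¬ HasInduced 8 (cycAdj 8) B)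
proposition2 B = mk⇔
  (λ (chordal , mir-chordal) →
      (λ h → mir-chordal 3 ≤-refl (threeK2⇒mir-C6 h)) , chordal 3 ≤-refl , chordal 4 (n≤1+n 3))
  (λ (no-3K₂ , no-C6 , no-C8) →
      chordalBipartite-by-length no-C6 no-C8
        (λ p → no-3K₂ ∘ HasInduced-⊑ (threeK2⊑long-cycle p))
    , chordalBipartite-by-length
        (no-3K₂ ∘ HasInduced-⊑ threeK2⊑bipComplement-C6 ∘ mir-cycle⇒bipComplement)
        (no-C8 ∘ HasInduced-⊑ C8⊑bipComplement-C8 ∘ mir-cycle⇒bipComplement)
        (λ p → no-C6 ∘ HasInduced-⊑ (C6⊑bipComplement-long-cycle p) ∘ mir-cycle⇒bipComplement))
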